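{- Let $k\ge 2$, $n\ge 1$, and let $B\subseteq Q_k^n$ be a latin bitrade with $2^n\le |B|<2^{n+1}$. Then $|B|=2^{n+1}-2^s$ for some $s\in\{1,\dots,n\}$.
   Context: Let $Q_k=\{0,1,\dots,k-1\}$ and $Q_k^n$ the set of words of length $n$ over $Q_k$. A one-dimensional face of direction $i$ through $(a_1,\dots,a_n)$ is $\{(a_1,\dots,a_{i-1},x,a_{i+1},\dots,a_n): x\in Q_k\}$. A set $B\subseteq Q_k^n$ is a latin bitrade if $|B\cap F|\in\{0,2\}$ for every one-dimensional face $F$. -}

module Defs where

open import Data.Nat using (ℕ)
open import Data.Fin using (Fin)
open import Data.Fin.Properties using (_≟_)
open import Data.Vec using (Vec; _[_]≔_)
open import Data.Vec.Properties using (≡-dec)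
open import Data.List using (List; length; filter; allFin)
import Data.List.Membership.DecPropositional as DecMem
open import Data.List.Relation.Unary.Unique.Propositional using (Unique)
open import Data.Product using (_×_)
open import Data.Sum using (_⊎_)
open import Relation.Binary.PropositionalEquality using (_≡_)
import Relation.Binary.Definitions

Word : ℕ → ℕ → Set
Word k n = Vec (Fin k) n

record WordSet (k n : ℕ) : Set where
  field
    elems  : List (Word k n)
    unique : Unique elems
open WordSet public

card : ∀ {k n} → WordSet k n → ℕ
card B = length (elems B)

-- |B ∩ F| where F is the one-dimensional face of direction i through a
faceCount : ∀ {k n} → WordSet k n → Fin n → Word k n → ℕ
faceCount {k} {n} B i a =
  length (filter (λ x → (a [ i ]≔ x) ∈? elems B) (allFin k))
  where
  decW : Relation.Binary.Definitions.DecidableEquality (Word k n)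
  decW = ≡-dec _≟_
  open DecMem decW using (_∈?_)

IsLatinBitrade : ∀ {k n} → WordSet k n → Set
IsLatinBitrade {n = n} B =
  (i : Fin n) (a : Word _ n) → (faceCount B i a ≡ 0) ⊎ (faceCount B i a ≡ 2)

-- Identify B with its indicator function. The words with a fixed first letter form a layer, itself
-- a bitrade of dimension n − 1, and since every line in the first direction meets B in 0 or 2
-- points, each layer holds at most half of B; inductively, a nonempty bitrade has at least 2^n
-- points. So if 2^n ≤ |B| < 2^(n+1), every nonempty layer has between 2^(n−1) and 2^n points and,
-- by induction on n (for n = 1, B is a single line with two points), size 2^n − 2^t with
-- 1 ≤ t ≤ n − 1. Hence there are two or three nonempty layers. Two layers, each at most half of B,
-- are equal, so |B| = 2^(n+1) − 2^(t+1). Of three layers, two have the minimal size 2^(n−1): two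
-- layers of size at least 3·2^(n−2) plus a third one would already reach 2^(n+1). Then
-- |B| = 2^(n+1) − 2^t.

module Submission where

open import Defs
open import Data.Nat using (ℕ; zero; suc; _+_; _*_; _^_; _∸_; _≤_; _<_; z≤n; s≤s)
open import Data.Nat.Properties hiding (_≟_; suc-injective)
open import Data.Nat.Tactic.RingSolver using (solve-∀)
open import Data.Fin using (Fin) renaming (zero to fzero; suc to fsuc)
open import Data.Fin.Properties using (_≟_; suc-injective)
open import Data.Vec using ([]; _∷_; lookup; _[_]≔_)
open import Data.Vec.Properties using (≡-dec; ∷-injectiveˡ; ∷-injectiveʳ; []≔-lookup)
open import Data.List using (List; []; _∷_; length; filter; tabulate)
import Data.Nat.ListAction as List
import Data.List.Relation.Unary.All as All
open All using (All; []; _∷_)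
open import Data.List.Relation.Unary.Any using (here; there)
open import Data.List.Relation.Unary.AllPairs using ([]; _∷_)
open import Data.List.Membership.Propositional using (_∈_)
import Data.List.Membership.DecPropositional as DecMembership
open import Data.List.Relation.Unary.Unique.Propositional using (Unique)
open import Data.Product using (Σ; ∃-syntax; _×_; _,_; proj₁; proj₂)
open import Data.Sum using (_⊎_; inj₁; inj₂) renaming (map to ⊎-map)
open import Data.Empty using (⊥-elim)
open import Function using (_∘_; id)
open import Relation.Nullary using (Dec; yes; no; ¬_)
open import Relation.Binary.Definitions using (DecidableEquality)
open import Relation.Binary.PropositionalEquality
  using (_≡_; refl; sym; trans; cong; cong₂; subst; subst₂; module ≡-Reasoning)
open import Algebra.Properties.CommutativeSemigroup +-commutativeSemigroup
  using (xy∙z≈xz∙y; x∙yz≈z∙xy; x∙yz≈y∙xz; x∙yz≈y∙zx; x∙yz≈x∙zy)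
open import Algebra.Properties.Semiring.Sum +-*-semiring
  using (sum; sum-syntax; sum-cong-≗; sum-replicate-zero; ∑-distrib-+; ∑-comm; *-distribˡ-sum)

𝟙 : ∀ {P : Set} → Dec P → ℕ
𝟙 (yes _) = 1
𝟙 (no _)  = 0

𝟙≡1 : ∀ {P : Set} → P → (d : Dec P) → 𝟙 d ≡ 1
𝟙≡1 p (yes _) = refl
𝟙≡1 p (no ¬p) = ⊥-elim (¬p p)

𝟙≡0 : ∀ {P : Set} → ¬ P → (d : Dec P) → 𝟙 d ≡ 0
𝟙≡0 ¬p (yes p) = ⊥-elim (¬p p)
𝟙≡0 ¬p (no _)  = refl

𝟙-cong : ∀ {P Q : Set} → (P → Q) → (Q → P) → (p : Dec P) (q : Dec Q) → 𝟙 p ≡ 𝟙 q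
𝟙-cong to from (yes p) q = sym (𝟙≡1 (to p) q)
𝟙-cong to from (no ¬p) q = sym (𝟙≡0 (¬p ∘ from) q)

𝟙≤1 : ∀ {P : Set} (d : Dec P) → 𝟙 d ≤ 1
𝟙≤1 (yes _) = s≤s z≤n
𝟙≤1 (no _)  = z≤n

sum-mono-≤ : ∀ {k} {f g : Fin k → ℕ} → (∀ i → f i ≤ g i) → sum f ≤ sum g
sum-mono-≤ {zero}  f≤g = z≤n
sum-mono-≤ {suc k} f≤g = +-mono-≤ (f≤g fzero) (sum-mono-≤ (f≤g ∘ fsuc))

term≤sum : ∀ {k} (f : Fin k → ℕ) i → f i ≤ sum f
term≤sum f fzero    = m≤m+n (f fzero) _
term≤sum f (fsuc i) = ≤-trans (term≤sum (f ∘ fsuc) i) (m≤n+m _ (f fzero))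

sum>0⇒∃term>0 : ∀ {k} (f : Fin k → ℕ) → 0 < sum f → ∃[ i ] 0 < f i
sum>0⇒∃term>0 {suc k} f pos with f fzero in eq
... | suc _ = fzero , subst (0 <_) (sym eq) (s≤s z≤n)
... | zero  = let i , 0<f[1+i] = sum>0⇒∃term>0 (f ∘ fsuc) pos in fsuc i , 0<f[1+i]

sum-𝟙≟ : ∀ {k} (x : Fin k) → ∑[ y < k ] 𝟙 (y ≟ x) ≡ 1
sum-𝟙≟ {suc k} fzero = cong₂ _+_ (𝟙≡1 refl (fzero {k} ≟ fzero))
  (trans (sum-cong-≗ {k} (λ y → 𝟙≡0 (λ ()) (fsuc y ≟ fzero))) (sum-replicate-zero k))
sum-𝟙≟ {suc k} (fsuc x) = cong₂ _+_ (𝟙≡0 (λ ()) (fzero ≟ fsuc x))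
  (trans (sum-cong-≗ {k} (λ y → 𝟙-cong suc-injective (cong fsuc) (fsuc y ≟ fsuc x) (y ≟ x)))
         (sum-𝟙≟ x))

length-filter-tabulate : ∀ {A : Set} {k} {P : A → Set} (P? : ∀ a → Dec (P a)) (g : Fin k → A) →
  length (filter P? (tabulate g)) ≡ ∑[ x < k ] 𝟙 (P? (g x))
length-filter-tabulate {k = zero}  P? g = refl
length-filter-tabulate {k = suc k} P? g with P? (g fzero)
... | yes _ = cong suc (length-filter-tabulate P? (g ∘ fsuc))
... | no _  = length-filter-tabulate P? (g ∘ fsuc)

module _ {k : ℕ} where

  ∑ʷ : ∀ {n} → (Word k n → ℕ) → ℕ
  ∑ʷ {zero}  f = f []
  ∑ʷ {suc n} f = ∑[ x < k ] ∑ʷ (λ w → f (x ∷ w))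

  ∑ʷ-cong : ∀ {n} {f g : Word k n → ℕ} → (∀ w → f w ≡ g w) → ∑ʷ f ≡ ∑ʷ g
  ∑ʷ-cong {zero}  f≗g = f≗g []
  ∑ʷ-cong {suc n} f≗g = sum-cong-≗ {k} (λ x → ∑ʷ-cong (λ w → f≗g (x ∷ w)))

  ∑ʷ-zero : ∀ {n} → ∑ʷ {n} (λ _ → 0) ≡ 0
  ∑ʷ-zero {zero}  = refl
  ∑ʷ-zero {suc n} = trans (sum-cong-≗ {k} (λ _ → ∑ʷ-zero {n})) (sum-replicate-zero k)

  ∑ʷ-distrib-+ : ∀ {n} (f g : Word k n → ℕ) → ∑ʷ (λ w → f w + g w) ≡ ∑ʷ f + ∑ʷ g
  ∑ʷ-distrib-+ {zero}  f g = refl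
  ∑ʷ-distrib-+ {suc n} f g =
    trans (sum-cong-≗ {k} (λ x → ∑ʷ-distrib-+ (λ w → f (x ∷ w)) (λ w → g (x ∷ w))))
          (∑-distrib-+ (λ x → ∑ʷ (λ w → f (x ∷ w))) (λ x → ∑ʷ (λ w → g (x ∷ w))))

  *-distribˡ-∑ʷ : ∀ {n} a (f : Word k n → ℕ) → a * ∑ʷ f ≡ ∑ʷ (λ w → a * f w)
  *-distribˡ-∑ʷ {zero}  a f = refl
  *-distribˡ-∑ʷ {suc n} a f =
    trans (*-distribˡ-sum a (λ x → ∑ʷ (λ w → f (x ∷ w))))
          (sum-cong-≗ {k} (λ x → *-distribˡ-∑ʷ a (λ w → f (x ∷ w))))

  ∑ʷ-mono-≤ : ∀ {n} {f g : Word k n → ℕ} → (∀ w → f w ≤ g w) → ∑ʷ f ≤ ∑ʷ g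
  ∑ʷ-mono-≤ {zero}  f≤g = f≤g []
  ∑ʷ-mono-≤ {suc n} f≤g = sum-mono-≤ (λ x → ∑ʷ-mono-≤ (λ w → f≤g (x ∷ w)))

  ∑ʷ-∑-comm : ∀ {n m} (f : Fin m → Word k n → ℕ) →
    ∑ʷ (λ w → ∑[ y < m ] f y w) ≡ ∑[ y < m ] ∑ʷ (f y)
  ∑ʷ-∑-comm {zero}  f = refl
  ∑ʷ-∑-comm {suc n} f =
    trans (sum-cong-≗ {k} (λ x → ∑ʷ-∑-comm (λ y w → f y (x ∷ w))))
          (∑-comm (λ x y → ∑ʷ (λ w → f y (x ∷ w))))

  _≟ʷ_ : ∀ {n} → DecidableEquality (Word k n)
  _≟ʷ_ = ≡-dec _≟_

  ∑ʷ-𝟙≟ : ∀ {n} (v : Word k n) → ∑ʷ (λ w → 𝟙 (w ≟ʷ v)) ≡ 1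
  ∑ʷ-𝟙≟ [] = 𝟙≡1 refl ([] ≟ʷ [])
  ∑ʷ-𝟙≟ {suc n} (x ∷ v) = trans (sum-cong-≗ {k} layer) (sum-𝟙≟ x)
    where
    -- `with y ≟ x` would also abstract the copy of y ≟ x inside (y ∷ w) ≟ʷ (x ∷ v).
    layer : ∀ y → ∑ʷ (λ w → 𝟙 ((y ∷ w) ≟ʷ (x ∷ v))) ≡ 𝟙 (y ≟ x)
    layer y = cases (y ≟ x)
      where
      cases : (y≟x : Dec (y ≡ x)) → ∑ʷ (λ w → 𝟙 ((y ∷ w) ≟ʷ (x ∷ v))) ≡ 𝟙 y≟x
      cases (yes y≡x) = trans (∑ʷ-cong (λ w → 𝟙-cong ∷-injectiveʳ (cong₂ _∷_ y≡x)
                                                ((y ∷ w) ≟ʷ (x ∷ v)) (w ≟ʷ v)))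
                              (∑ʷ-𝟙≟ v)
      cases (no y≢x)  = trans (∑ʷ-cong (λ w → 𝟙≡0 (y≢x ∘ ∷-injectiveˡ) ((y ∷ w) ≟ʷ (x ∷ v))))
                              (∑ʷ-zero {n})

  _∈ʷ?_ : ∀ {n} (w : Word k n) (L : List (Word k n)) → Dec (w ∈ L)
  _∈ʷ?_ = DecMembership._∈?_ _≟ʷ_

  length≡∑ʷ-𝟙∈ : ∀ {n} (L : List (Word k n)) → Unique L → length L ≡ ∑ʷ (λ w → 𝟙 (w ∈ʷ? L))
  length≡∑ʷ-𝟙∈ {n} [] [] =
    sym (trans (∑ʷ-cong {n} (λ w → 𝟙≡0 (λ ()) (w ∈ʷ? []))) (∑ʷ-zero {n}))
  length≡∑ʷ-𝟙∈ (v ∷ L) (v∉L ∷ uniqueL) = begin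
    suc (length L)                     ≡⟨ cong₂ _+_ (sym (∑ʷ-𝟙≟ v)) (length≡∑ʷ-𝟙∈ L uniqueL) ⟩
    ∑ʷ is-v + ∑ʷ in-L                  ≡⟨ ∑ʷ-distrib-+ is-v in-L ⟨
    ∑ʷ (λ w → is-v w + in-L w)         ≡⟨ ∑ʷ-cong split ⟩
    ∑ʷ (λ w → 𝟙 (w ∈ʷ? (v ∷ L)))       ∎
    where
    open ≡-Reasoning
    is-v in-L : Word k _ → ℕ
    is-v w = 𝟙 (w ≟ʷ v)
    in-L w = 𝟙 (w ∈ʷ? L)
    split : ∀ w → is-v w + in-L w ≡ 𝟙 (w ∈ʷ? (v ∷ L))
    split w = cases (w ≟ʷ v)
      where
      cases : (w≟v : Dec (w ≡ v)) → 𝟙 w≟v + 𝟙 (w ∈ʷ? L) ≡ 𝟙 (w ∈ʷ? (v ∷ L))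
      cases (yes w≡v) = trans (cong suc (𝟙≡0 (λ w∈L → All.lookup v∉L w∈L (sym w≡v)) (w ∈ʷ? L)))
                              (sym (𝟙≡1 (here w≡v) (w ∈ʷ? (v ∷ L))))
      cases (no w≢v)  = 𝟙-cong there (λ { (here w≡v) → ⊥-elim (w≢v w≡v) ; (there w∈L) → w∈L })
                               (w ∈ʷ? L) (w ∈ʷ? (v ∷ L))

2^[1+n]≡2^n+2^n : ∀ n → 2 ^ suc n ≡ 2 ^ n + 2 ^ n
2^[1+n]≡2^n+2^n n = cong (2 ^ n +_) (+-identityʳ (2 ^ n))

-- c = 2^(n+1) − 2^s, written additively to avoid truncated subtraction.
PowerGap : ℕ → ℕ → Set
PowerGap n c = ∃[ s ] (1 ≤ s × s ≤ n) × c + 2 ^ s ≡ 2 ^ suc n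

powerGap-bounds : ∀ {n c} → PowerGap n c → 2 ^ n ≤ c × c < 2 ^ suc n
powerGap-bounds {n} {c} (s , (_ , s≤n) , gap) = lower , upper
  where
  open ≤-Reasoning
  lower : 2 ^ n ≤ c
  lower = +-cancelʳ-≤ (2 ^ s) (2 ^ n) c (begin
    2 ^ n + 2 ^ s        ≤⟨ +-monoʳ-≤ (2 ^ n) (^-monoʳ-≤ 2 s≤n) ⟩
    2 ^ n + 2 ^ n        ≡⟨ 2^[1+n]≡2^n+2^n n ⟨
    2 ^ suc n            ≡⟨ gap ⟨
    c + 2 ^ s            ∎)
  upper : c < 2 ^ suc n
  upper = subst (c <_) gap (m<m+n c (m^n>0 2 s))

powerGap-double : ∀ {n c} → PowerGap n c → PowerGap (suc n) (2 * c)
powerGap-double {n} {c} (s , (1≤s , s≤n) , gap) =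
  suc s , (m≤n⇒m≤1+n 1≤s , s≤s s≤n) , trans (sym (*-distribˡ-+ 2 c (2 ^ s))) (cong (2 *_) gap)

powerGap-shift : ∀ {n c} → PowerGap n c → PowerGap (suc n) (c + (2 ^ n + 2 ^ n))
powerGap-shift {n} {c} (s , (1≤s , s≤n) , gap) =
  s , (1≤s , m≤n⇒m≤1+n s≤n) , (begin
    c + (2 ^ n + 2 ^ n) + 2 ^ s      ≡⟨ cong (λ d → c + d + 2 ^ s) (2^[1+n]≡2^n+2^n n) ⟨
    c + 2 ^ suc n + 2 ^ s            ≡⟨ xy∙z≈xz∙y c (2 ^ suc n) (2 ^ s) ⟩
    c + 2 ^ s + 2 ^ suc n            ≡⟨ cong (_+ 2 ^ suc n) gap ⟩
    2 ^ suc n + 2 ^ suc n            ≡⟨ 2^[1+n]≡2^n+2^n (suc n) ⟨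
    2 ^ suc (suc n)                  ∎)
  where open ≡-Reasoning

powerGap-dichotomy : ∀ {n c} → PowerGap n c → c ≡ 2 ^ n ⊎ 3 * 2 ^ n ≤ 2 * c
powerGap-dichotomy {n} {c} (s , (_ , s≤n) , gap) with m≤n⇒m<n∨m≡n s≤n
... | inj₂ refl = inj₁ (+-cancelʳ-≡ (2 ^ n) c (2 ^ n)
                         (trans gap (2^[1+n]≡2^n+2^n n)))
... | inj₁ s<n  = inj₂ (+-cancelʳ-≤ P (3 * P) (2 * c) (begin
    3 * P + P            ≡⟨ four P ⟩
    2 * (2 * P)          ≡⟨ cong (2 *_) gap ⟨
    2 * (c + 2 ^ s)      ≡⟨ *-distribˡ-+ 2 c (2 ^ s) ⟩
    2 * c + 2 ^ suc s    ≤⟨ +-monoʳ-≤ (2 * c) (^-monoʳ-≤ 2 s<n) ⟩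
    2 * c + P            ∎))
  where
  open ≤-Reasoning
  P = 2 ^ n
  four : ∀ P → 3 * P + P ≡ 2 * (2 * P)
  four = solve-∀

¬twoBig : ∀ {P x y z} → 3 * P ≤ 2 * x → 3 * P ≤ 2 * y → P ≤ z → ¬ (x + (y + z) < 2 * (2 * P))
¬twoBig {P} {x} {y} {z} x-big y-big P≤z sum<4P = <-irrefl refl (<-≤-trans
  (*-monoʳ-< 2 sum<4P)
  (begin
    2 * (2 * (2 * P))           ≡⟨ eight P ⟩
    3 * P + (3 * P + 2 * P)     ≤⟨ +-mono-≤ x-big (+-mono-≤ y-big (*-monoʳ-≤ 2 P≤z)) ⟩
    2 * x + (2 * y + 2 * z)     ≡⟨ distrib x y z ⟨
    2 * (x + (y + z))           ∎))
  where
  open ≤-Reasoning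
  eight : ∀ P → 2 * (2 * (2 * P)) ≡ 3 * P + (3 * P + 2 * P)
  eight = solve-∀
  distrib : ∀ x y z → 2 * (x + (y + z)) ≡ 2 * x + (2 * y + 2 * z)
  distrib = solve-∀

powerGap-three : ∀ {n a b c} → PowerGap n a → PowerGap n b → PowerGap n c →
  a + (b + c) < 2 ^ suc (suc n) → PowerGap (suc n) (a + (b + c))
powerGap-three {n} {a} {b} {c} ga gb gc sum<
  with powerGap-dichotomy ga | powerGap-dichotomy gb | powerGap-dichotomy gc
... | inj₁ refl  | inj₁ refl  | _          =
  subst (PowerGap (suc n)) (sym (x∙yz≈z∙xy (2 ^ n) (2 ^ n) c)) (powerGap-shift gc)
... | inj₁ refl  | inj₂ _     | inj₁ refl  =
  subst (PowerGap (suc n)) (sym (x∙yz≈y∙xz (2 ^ n) b (2 ^ n))) (powerGap-shift gb)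
... | inj₂ _     | inj₁ refl  | inj₁ refl  = powerGap-shift ga
... | inj₁ refl  | inj₂ b-big | inj₂ c-big =
  ⊥-elim (¬twoBig {x = b} {c} b-big c-big (proj₁ (powerGap-bounds ga))
                  (subst (_< 2 ^ suc (suc n)) (x∙yz≈y∙zx (2 ^ n) b c) sum<))
... | inj₂ a-big | inj₁ refl  | inj₂ c-big =
  ⊥-elim (¬twoBig {x = a} {c} a-big c-big (proj₁ (powerGap-bounds gb))
                  (subst (_< 2 ^ suc (suc n)) (x∙yz≈x∙zy a (2 ^ n) c) sum<))
... | inj₂ a-big | inj₂ b-big | _          =
  ⊥-elim (¬twoBig {x = a} {b} a-big b-big (proj₁ (powerGap-bounds gc)) sum<)

both-halves⇒≡ : ∀ {a b} → 2 * a ≤ a + b → 2 * b ≤ a + b → a ≡ b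
both-halves⇒≡ {a} {b} 2a≤ 2b≤ = ≤-antisym
  (+-cancelˡ-≤ a a b (subst (_≤ a + b) (cong (a +_) (+-identityʳ a)) 2a≤))
  (+-cancelʳ-≤ b b a (subst (_≤ a + b) (cong (b +_) (+-identityʳ b)) 2b≤))

powerGap-sum : ∀ {n} (vs : List ℕ) → All (λ v → PowerGap n v × 2 * v ≤ List.sum vs) vs →
  2 ^ suc n ≤ List.sum vs → List.sum vs < 2 ^ suc (suc n) → PowerGap (suc n) (List.sum vs)
powerGap-sum {n} [] _ lo _ = ⊥-elim (<⇒≱ (m^n>0 2 (suc n)) lo)
powerGap-sum {n} (a ∷ []) ((ga , _) ∷ []) lo _ =
  ⊥-elim (<⇒≱ (proj₂ (powerGap-bounds ga)) (subst (2 ^ suc n ≤_) (+-identityʳ a) lo))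
powerGap-sum {n} (a ∷ b ∷ []) ((ga , 2a≤) ∷ (_ , 2b≤) ∷ []) _ _
  with both-halves⇒≡ {a} {b} (subst (2 * a ≤_) (cong (a +_) (+-identityʳ b)) 2a≤)
                             (subst (2 * b ≤_) (cong (a +_) (+-identityʳ b)) 2b≤)
... | refl = powerGap-double ga
powerGap-sum {n} (a ∷ b ∷ c ∷ []) ((ga , _) ∷ (gb , _) ∷ (gc , _) ∷ []) _ sum< =
  subst (PowerGap (suc n)) (sym c+0≡c) (powerGap-three ga gb gc (subst (_< 2 ^ suc (suc n)) c+0≡c sum<))
  where
  c+0≡c : a + (b + (c + 0)) ≡ a + (b + c)
  c+0≡c = cong (λ d → a + (b + d)) (+-identityʳ c)
powerGap-sum {n} (a ∷ b ∷ c ∷ d ∷ vs) ((ga , _) ∷ (gb , _) ∷ (gc , _) ∷ (gd , _) ∷ _) _ sum< =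
  ⊥-elim (<⇒≱ sum< (begin
    2 ^ suc (suc n)                       ≡⟨ four (2 ^ n) ⟩
    2 ^ n + (2 ^ n + (2 ^ n + 2 ^ n))     ≤⟨ +-mono-≤ (lower ga) (+-mono-≤ (lower gb)
                                               (+-mono-≤ (lower gc) (≤-trans (lower gd) (m≤m+n d _)))) ⟩
    List.sum (a ∷ b ∷ c ∷ d ∷ vs)          ∎))
  where
  open ≤-Reasoning
  lower : ∀ {v} → PowerGap n v → 2 ^ n ≤ v
  lower = proj₁ ∘ powerGap-bounds
  four : ∀ P → 2 * (2 * P) ≡ P + (P + (P + P))
  four = solve-∀

nonzeros : ∀ {k} → (Fin k → ℕ) → List ℕ
nonzeros {zero}  f = []
nonzeros {suc k} f with f fzero
... | zero  = nonzeros (f ∘ fsuc)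
... | suc v = suc v ∷ nonzeros (f ∘ fsuc)

sum-nonzeros : ∀ {k} (f : Fin k → ℕ) → List.sum (nonzeros f) ≡ sum f
sum-nonzeros {zero}  f = refl
sum-nonzeros {suc k} f with f fzero
... | zero  = sum-nonzeros (f ∘ fsuc)
... | suc v = cong (suc v +_) (sum-nonzeros (f ∘ fsuc))

All-nonzeros : ∀ {k} {Q : ℕ → Set} (f : Fin k → ℕ) → (∀ i → 0 < f i → Q (f i)) → All Q (nonzeros f)
All-nonzeros {zero}  f q = []
All-nonzeros {suc k} f q with f fzero | q fzero
... | zero  | _  = All-nonzeros (f ∘ fsuc) (q ∘ fsuc)
... | suc v | q₀ = q₀ (s≤s z≤n) ∷ All-nonzeros (f ∘ fsuc) (q ∘ fsuc)

module _ {k : ℕ} where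

  lineSum : ∀ {n} → (Word k n → ℕ) → Fin n → Word k n → ℕ
  lineSum χ i a = ∑[ x < k ] χ (a [ i ]≔ x)

  record IsBitrade {n} (χ : Word k n → ℕ) : Set where
    field
      ≤1   : ∀ w → χ w ≤ 1
      line : ∀ i a → lineSum χ i a ≡ 0 ⊎ lineSum χ i a ≡ 2

  layer : ∀ {n} {χ : Word k (suc n) → ℕ} → IsBitrade χ → ∀ y → IsBitrade (λ w → χ (y ∷ w))
  layer bt y = record
    { ≤1   = λ w → IsBitrade.≤1 bt (y ∷ w)
    ; line = λ i a → IsBitrade.line bt (fsuc i) (y ∷ a)
    }

  2*≤lineSum : ∀ {n} {χ : Word k n → ℕ} → IsBitrade χ → ∀ i a → 2 * χ a ≤ lineSum χ i a
  2*≤lineSum {χ = χ} bt i a = double≤ (IsBitrade.≤1 bt a) χa≤line (IsBitrade.line bt i a)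
    where
    χa≤line : χ a ≤ lineSum χ i a
    χa≤line = subst (_≤ lineSum χ i a) (cong χ ([]≔-lookup a i))
                    (term≤sum (λ x → χ (a [ i ]≔ x)) (lookup a i))
    double≤ : ∀ {v s} → v ≤ 1 → v ≤ s → s ≡ 0 ⊎ s ≡ 2 → 2 * v ≤ s
    double≤ z≤n             _   _          = z≤n
    double≤ (s≤s z≤n)       ()  (inj₁ refl)
    double≤ (s≤s z≤n)       _   (inj₂ refl) = ≤-refl

  2*∑ʷlayer≤∑ʷ : ∀ {n} {χ : Word k (suc n) → ℕ} → IsBitrade χ → ∀ y →
    2 * ∑ʷ (λ w → χ (y ∷ w)) ≤ ∑ʷ χ
  2*∑ʷlayer≤∑ʷ {χ = χ} bt y = begin
    2 * ∑ʷ (λ w → χ (y ∷ w))          ≡⟨ *-distribˡ-∑ʷ 2 (λ w → χ (y ∷ w)) ⟩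
    ∑ʷ (λ w → 2 * χ (y ∷ w))          ≤⟨ ∑ʷ-mono-≤ (λ w → 2*≤lineSum bt fzero (y ∷ w)) ⟩
    ∑ʷ (λ w → ∑[ x < k ] χ (x ∷ w))   ≡⟨ ∑ʷ-∑-comm (λ x w → χ (x ∷ w)) ⟩
    ∑ʷ χ                              ∎
    where open ≤-Reasoning

  2^n≤∑ʷ : ∀ {n} {χ : Word k n → ℕ} → IsBitrade χ → 0 < ∑ʷ χ → 2 ^ n ≤ ∑ʷ χ
  2^n≤∑ʷ {zero}  bt pos = pos
  2^n≤∑ʷ {suc n} {χ} bt pos with sum>0⇒∃term>0 (λ y → ∑ʷ (λ w → χ (y ∷ w))) pos
  ... | y , layer-pos =
    ≤-trans (*-monoʳ-≤ 2 (2^n≤∑ʷ (layer bt y) layer-pos)) (2*∑ʷlayer≤∑ʷ bt y)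

  1-dim-∑ʷ≡2 : {χ : Word k 1 → ℕ} → IsBitrade χ → 0 < ∑ʷ χ → ∑ʷ χ ≡ 2
  1-dim-∑ʷ≡2 {χ} bt pos with sum>0⇒∃term>0 (λ x → χ (x ∷ [])) pos
  ... | y , _ with IsBitrade.line bt fzero (y ∷ [])
  ...   | inj₁ ∑ʷ≡0 = ⊥-elim (<⇒≢ pos (sym ∑ʷ≡0))
  ...   | inj₂ ∑ʷ≡2 = ∑ʷ≡2

  bitrade-powerGap : ∀ {n} {χ : Word k (suc n) → ℕ} → IsBitrade χ →
    2 ^ suc n ≤ ∑ʷ χ → ∑ʷ χ < 2 ^ suc (suc n) → PowerGap (suc n) (∑ʷ χ)
  bitrade-powerGap {zero} bt lo _ =
    1 , (≤-refl , ≤-refl) , cong (_+ 2) (1-dim-∑ʷ≡2 bt (<-≤-trans (s≤s z≤n) lo))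
  bitrade-powerGap {suc n} {χ} bt lo sum< =
    subst (PowerGap (suc (suc n))) (sum-nonzeros layerSize)
      (powerGap-sum (nonzeros layerSize) (All-nonzeros layerSize layerGap)
                    (subst (2 ^ suc (suc n) ≤_) (sym (sum-nonzeros layerSize)) lo)
                    (subst (_< 2 ^ suc (suc (suc n))) (sym (sum-nonzeros layerSize)) sum<))
    where
    layerSize : Fin k → ℕ
    layerSize y = ∑ʷ (λ w → χ (y ∷ w))
    layerGap : ∀ y → 0 < layerSize y →
      PowerGap (suc n) (layerSize y) × 2 * layerSize y ≤ List.sum (nonzeros layerSize)
    layerGap y pos =
      bitrade-powerGap (layer bt y) (2^n≤∑ʷ (layer bt y) pos)
        (*-cancelˡ-< 2 (layerSize y) (2 ^ suc (suc n)) (≤-<-trans (2*∑ʷlayer≤∑ʷ bt y) sum<)) ,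
      subst (2 * layerSize y ≤_) (sym (sum-nonzeros layerSize)) (2*∑ʷlayer≤∑ʷ bt y)

𝟙∈ : ∀ {k n} → WordSet k n → Word k n → ℕ
𝟙∈ B w = 𝟙 (w ∈ʷ? elems B)

card≡∑ʷ𝟙∈ : ∀ {k n} (B : WordSet k n) → card B ≡ ∑ʷ (𝟙∈ B)
card≡∑ʷ𝟙∈ B = length≡∑ʷ-𝟙∈ (elems B) (unique B)

faceCount≡lineSum : ∀ {k n} (B : WordSet k n) i a → faceCount B i a ≡ lineSum (𝟙∈ B) i a
faceCount≡lineSum B i a = length-filter-tabulate (λ x → (a [ i ]≔ x) ∈ʷ? elems B) id

isLatinBitrade⇒isBitrade : ∀ {k n} (B : WordSet k n) → IsLatinBitrade B → IsBitrade (𝟙∈ B)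
isLatinBitrade⇒isBitrade B latin = record
  { ≤1   = λ w → 𝟙≤1 (w ∈ʷ? elems B)
  ; line = λ i a → ⊎-map (trans (sym (faceCount≡lineSum B i a)))
                           (trans (sym (faceCount≡lineSum B i a))) (latin i a)
  }

2^[n+1]≡2^[1+n] : ∀ n → 2 ^ (n + 1) ≡ 2 ^ suc n
2^[n+1]≡2^[1+n] n = cong (2 ^_) (+-comm n 1)

proposition6 : (k n : ℕ) → 2 ≤ k → 1 ≤ n → (B : WordSet k n) → IsLatinBitrade B →
    2 ^ n ≤ card B → card B < 2 ^ (n Data.Nat.+ 1) →
      Σ ℕ (λ s → (1 ≤ s × s ≤ n) × card B ≡ 2 ^ (n Data.Nat.+ 1) ∸ 2 ^ s)
proposition6 k (suc m) _ _ B latin lo hi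
  with bitrade-powerGap (isLatinBitrade⇒isBitrade B latin)
         (subst (2 ^ suc m ≤_) (card≡∑ʷ𝟙∈ B) lo)
         (subst₂ _<_ (card≡∑ʷ𝟙∈ B) (2^[n+1]≡2^[1+n] (suc m)) hi)
... | s , s∈[1,n] , gap = s , s∈[1,n] , (begin
    card B                              ≡⟨ card≡∑ʷ𝟙∈ B ⟩
    ∑ʷ (𝟙∈ B)                           ≡⟨ m+n∸n≡m (∑ʷ (𝟙∈ B)) (2 ^ s) ⟨
    ∑ʷ (𝟙∈ B) + 2 ^ s ∸ 2 ^ s           ≡⟨ cong (_∸ 2 ^ s) gap ⟩
    2 ^ suc (suc m) ∸ 2 ^ s             ≡⟨ cong (_∸ 2 ^ s) (2^[n+1]≡2^[1+n] (suc m)) ⟨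
    2 ^ (suc m + 1) ∸ 2 ^ s             ∎)
  where open ≡-Reasoning
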